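{- Let $\mathcal{G}$ be a set of positions closed under options, and let $A\in\{\mathbb{Z},\mathbb{D}\}$. Suppose $\mathcal{G}$ is partitioned into disjoint sets $\mathcal{D}$ and $\mathcal{S}$ such that (a) every $G\in\mathcal{D}$ has the $\Diamond_A$-property, and (b) for every $G\in\mathcal{S}$, all Left options and all Right options of $G$ belong to $\mathcal{D}$. Then (1) every $G\in\mathcal{G}$ satisfies $G\in\{A\mid A\}$, and (2) every $G\in\mathcal{D}$ satisfies $G\in A$.
   Context: Positions are short (finite, loop-free) combinatorial games $G=\{G^{\mathcal L}\mid G^{\mathcal R}\}$ with finite sets of Left/Right options; $G^L$, $G^R$ denote individual options. A set of positions is closed under options if every Left or Right option of a member is again a member. The relations $=,\le,<$ are the usual ones for games; $G\ngeq H$ means "$G<H$ or $G$ is fuzzy with $H$". $\mathbb{Z}$ and $\mathbb{D}$ (dyadic rationals) are viewed as games. For $A\in\{\mathbb{Z},\mathbb{D}\}$, "$G\in A$" means $G$ equals some element of $A$, and $\{A\mid A\}$ is the set of positions equal to $\{a\mid b\}$ for some $a,b\in A$. The $A$-stops: $\mathrm{LS}_A(G)=\mathrm{RS}_A(G)=$ the element of $A$ equal to $G$ if $G\in A$; otherwise $\mathrm{LS}_A(G)=\max_{G^L}\mathrm{RS}_A(G^L)$, $\mathrm{RS}_A(G)=\min_{G^R}\mathrm{LS}_A(G^R)$. Guide options: $\mathrm{gd}^L_A(G)=\emptyset$ if $G\in A$; if $G\notin A$ and some Left option equals $\mathrm{LS}_A(G)$, then $\mathrm{gd}^L_A(G)=\{G^L:G^L=\mathrm{LS}_A(G)\}$;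 otherwise $\mathrm{gd}^L_A(G)=\{G^L:\mathrm{RS}_A(G^L)=\mathrm{LS}_A(G)\}$. Dually $\mathrm{gd}^R_A(G)=\emptyset$ if $G\in A$; if $G\notin A$ and some Right option equals $\mathrm{RS}_A(G)$ then $\mathrm{gd}^R_A(G)=\{G^R:G^R=\mathrm{RS}_A(G)\}$; otherwise $\mathrm{gd}^R_A(G)=\{G^R:\mathrm{LS}_A(G^R)=\mathrm{RS}_A(G)\}$. $G$ has the $\Diamond_A$-property if $G\in A$, or there exist $G^L\in\mathrm{gd}^L_A(G)$, $G^R\in\mathrm{gd}^R_A(G)$, $x\in A$ with $G^L\ngeq x$ and $x\ngeq G^R$. -}

module Defs where

open import Data.Nat as ℕ using (ℕ; zero; suc; _^_)
open import Data.Integer as ℤ using (ℤ; +_; -[1+_]; _/ℕ_; _%ℕ_)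
open import Data.List using (List; []; _∷_; [_])
open import Data.List.Membership.Propositional using (_∈_)
open import Data.List.Relation.Unary.Any using (Any)
open import Data.List.Relation.Unary.All using (All)
open import Data.Product using (Σ; _×_)
open import Data.Sum using (_⊎_)
open import Relation.Nullary using (¬_)

data Game : Set where
  ⟨_∣_⟩ : List Game → List Game → Game

Ls : Game → List Game
Ls ⟨ l ∣ r ⟩ = l

Rs : Game → List Game
Rs ⟨ l ∣ r ⟩ = r

-- The usual order.  G ≤ H iff no G^L ≥ H and no H^R ≤ G.
-- G ⧏ H ("H ≤ G fails") iff some H^L ≥ G or some G^R ≤ H.

infix 4 _≤_ _⧏_ _≈_ _≱_

mutual
  data _≤_ : Game → Game → Set where
    le : ∀ {G H} →
         (∀ {x} → x ∈ Ls G → x ⧏ H) →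
         (∀ {y} → y ∈ Rs H → G ⧏ y) →
         G ≤ H

  data _⧏_ : Game → Game → Set where
    ⧏L : ∀ {G H x} → x ∈ Ls H → G ≤ x → G ⧏ H
    ⧏R : ∀ {G H y} → y ∈ Rs G → y ≤ H → G ⧏ H

_≈_ : Game → Game → Set
G ≈ H = (G ≤ H) × (H ≤ G)

_≱_ : Game → Game → Set
G ≱ H = ¬ (H ≤ G)

0G : Game
0G = ⟨ [] ∣ [] ⟩

intG : ℤ → Game
intG (+ zero)        = 0G
intG (+ suc n)       = ⟨ [ intG (+ n) ] ∣ [] ⟩
intG -[1+ zero ]     = ⟨ [] ∣ [ 0G ] ⟩
intG -[1+ suc n ]    = ⟨ [] ∣ [ intG -[1+ n ] ] ⟩

-- dyG m k is the game of the dyadic rational m / 2^k :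
--   m even : m/2^(k+1) = (m/2)/2^k
--   m odd  : m/2^(k+1) = { ⌊m/2⌋/2^k | (⌊m/2⌋+1)/2^k }  (canonical form)
dyG : ℤ → ℕ → Game
dyG m zero = intG m
dyG m (suc k) with m %ℕ 2
... | zero  = dyG (m /ℕ 2) k
... | suc _ = ⟨ [ dyG (m /ℕ 2) k ] ∣ [ dyG ((m /ℕ 2) ℤ.+ + 1) k ] ⟩

record NumSys : Set₁ where
  field
    Carrier : Set
    _≤ₐ_    : Carrier → Carrier → Set
    emb     : Carrier → Game

ℤSys : NumSys
ℤSys = record { Carrier = ℤ ; _≤ₐ_ = ℤ._≤_ ; emb = intG }

-- A = 𝔻 : a pair (m , k) denotes m / 2^k
𝔻 : Set
𝔻 = ℤ × ℕ

_≤𝔻_ : 𝔻 → 𝔻 → Set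
(m Data.Product., k) ≤𝔻 (n Data.Product., j) = (m ℤ.* + (2 ^ j)) ℤ.≤ (n ℤ.* + (2 ^ k))

𝔻Sys : NumSys
𝔻Sys = record { Carrier = 𝔻 ; _≤ₐ_ = _≤𝔻_ ; emb = λ { (m Data.Product., k) → dyG m k } }

data Which : Set where
  Z D : Which

sys : Which → NumSys
sys Z = ℤSys
sys D = 𝔻Sys

module _ (A : NumSys) where
  open NumSys A

  InA : Game → Set
  InA G = Σ Carrier λ a → G ≈ emb a

  InAA : Game → Set
  InAA G = Σ Carrier λ a → Σ Carrier λ b → G ≈ ⟨ [ emb a ] ∣ [ emb b ] ⟩

  -- A-stops, as relations: LS G a means "LS_A(G) = a".
  -- For G ∉ A, LS_A(G) = max over G^L of RS_A(G^L): some G^L has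
  -- right stop a and every G^L has a right stop b ≤ a.
  mutual
    data LS : Game → Carrier → Set where
      LS-num  : ∀ {G a} → G ≈ emb a → LS G a
      LS-game : ∀ {G a} → ¬ InA G →
                Any (λ x → RS x a) (Ls G) →
                All (λ x → Σ Carrier λ b → RS x b × (b ≤ₐ a)) (Ls G) →
                LS G a

    data RS : Game → Carrier → Set where
      RS-num  : ∀ {G a} → G ≈ emb a → RS G a
      RS-game : ∀ {G a} → ¬ InA G →
                Any (λ y → LS y a) (Rs G) →
                All (λ y → Σ Carrier λ b → LS y b × (a ≤ₐ b)) (Rs G) →
                RS G a

  GdL : Game → Game → Set
  GdL G x = ¬ InA G × x ∈ Ls G × Σ Carrier λ a → LS G a ×
            ((Any (λ y → y ≈ emb a) (Ls G) → x ≈ emb a) ×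
             (¬ Any (λ y → y ≈ emb a) (Ls G) → RS x a))

  GdR : Game → Game → Set
  GdR G y = ¬ InA G × y ∈ Rs G × Σ Carrier λ a → RS G a ×
            ((Any (λ z → z ≈ emb a) (Rs G) → y ≈ emb a) ×
             (¬ Any (λ z → z ≈ emb a) (Rs G) → LS y a))

  Diamond : Game → Set
  Diamond G = InA G ⊎
    Σ Game λ GL → Σ Game λ GR → Σ Carrier λ c →
      GdL G GL × GdR G GR × (GL ≱ emb c) × (emb c ≱ GR)

ClosedUnderOptions : (Game → Set) → Set
ClosedUnderOptions 𝒢 = ∀ {G x} → 𝒢 G → (x ∈ Ls G ⊎ x ∈ Rs G) → 𝒢 x

-- Induction on positions: every G ∈ 𝒟 is in A and every G ∈ 𝒮 has all its options in A.
-- So each option y of G ∈ 𝒟 is in A or has only options in A, and for such y a number c ≤ y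
-- lies below the right stop of y (strictly, unless y equals it), while a number strictly below
-- the right stop lies below y. Hence if the ◇-witness c satisfied c ≤ G^L for some left option,
-- c would lie below the left stop and then below the left guide option, contradicting
-- G^L_guide ≱ c; dually on the right. Thus G^L ⧏ c ⧏ G^R throughout, and by the simplicity
-- theorem G is a number. A position whose options are all in A equals {max G^L | min G^R}, or a
-- number when one side is empty, and every number is in {A | A}.

module Submission where

open import Defs
open import Data.Empty using (⊥-elim)
open import Function using (id)
open import Data.Integer as ℤ using (ℤ; +_; -[1+_]; _/ℕ_; _%ℕ_)
import Data.Integer.Properties as ℤP
open import Data.Integer.DivMod using (a≡a%ℕn+[a/ℕn]*n; n%ℕd<d)
open import Data.Integer.Tactic.RingSolver using (solve-∀)
open import Data.List using ([]; _∷_; [_])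
open import Data.List.Membership.Propositional using (_∈_; find; lose)
open import Data.List.Relation.Unary.Any using (Any; here; there; any?)
open import Data.List.Relation.Unary.All as All using (All; all?; [])
open import Data.Nat as ℕ using (zero; suc; _^_)
import Data.Nat.Properties as ℕP
open import Data.Product using (∃; ∃₂; _×_; _,_; proj₁; proj₂)
open import Data.Sum as Sum using (_⊎_; inj₁; inj₂; [_,_]′)
open import Relation.Binary.PropositionalEquality
  using (_≡_; _≢_; refl; sym; trans; cong; subst; subst₂; module ≡-Reasoning)
open import Relation.Nullary using (¬_; Dec; yes; no)
open import Relation.Nullary.Decidable using (_×-dec_)

-- Games

module _ (P : Game → Set)
         (step : ∀ G → (∀ {x} → x ∈ Ls G → P x) → (∀ {x} → x ∈ Rs G → P x) → P G) where
  mutual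
    game-ind : ∀ G → P G
    game-ind ⟨ L ∣ R ⟩ = step ⟨ L ∣ R ⟩ (game-ind-∈ L) (game-ind-∈ R)

    game-ind-∈ : ∀ L {x} → x ∈ L → P x
    game-ind-∈ (x ∷ _) (here refl) = game-ind x
    game-ind-∈ (_ ∷ L) (there x∈L) = game-ind-∈ L x∈L

≤-refl : ∀ G → G ≤ G
≤-refl = game-ind (λ G → G ≤ G) λ _ ihL ihR → le (λ x∈ → ⧏L x∈ (ihL x∈)) (λ y∈ → ⧏R y∈ (ihR y∈))

≤⇒¬⧏ : ∀ {G H} → G ≤ H → ¬ H ⧏ G
≤⇒¬⧏ (le GL⧏H _) (⧏L x∈ H≤x) = ≤⇒¬⧏ H≤x (GL⧏H x∈)
≤⇒¬⧏ (le _ G⧏HR) (⧏R y∈ y≤G) = ≤⇒¬⧏ y≤G (G⧏HR y∈)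

mutual
  ≤-trans : ∀ {G H K} → G ≤ H → H ≤ K → G ≤ K
  ≤-trans G≤H@(le GL⧏H _) H≤K@(le _ H⧏KR) =
    le (λ x∈ → ⧏-≤-trans (GL⧏H x∈) H≤K) (λ y∈ → ≤-⧏-trans G≤H (H⧏KR y∈))

  ⧏-≤-trans : ∀ {G H K} → G ⧏ H → H ≤ K → G ⧏ K
  ⧏-≤-trans (⧏L x∈ G≤x) (le HL⧏K _) = ≤-⧏-trans G≤x (HL⧏K x∈)
  ⧏-≤-trans (⧏R y∈ y≤H) H≤K = ⧏R y∈ (≤-trans y≤H H≤K)

  ≤-⧏-trans : ∀ {G H K} → G ≤ H → H ⧏ K → G ⧏ K
  ≤-⧏-trans G≤H (⧏L x∈ H≤x) = ⧏L x∈ (≤-trans G≤H H≤x)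
  ≤-⧏-trans (le _ G⧏HR) (⧏R y∈ y≤K) = ⧏-≤-trans (G⧏HR y∈) y≤K

≈-trans : ∀ {G H K} → G ≈ H → H ≈ K → G ≈ K
≈-trans (G≤H , H≤G) (H≤K , K≤H) = ≤-trans G≤H H≤K , ≤-trans K≤H H≤G

infix 4 _<_
_<_ : Game → Game → Set
G < H = G ≤ H × G ⧏ H

mutual
  ≤⊎⧏ : ∀ G H → G ≤ H ⊎ H ⧏ G
  ≤⊎⧏ ⟨ L ∣ R ⟩ ⟨ L′ ∣ R′ ⟩ with all⧏⊎some≥ L ⟨ L′ ∣ R′ ⟩ | all⧏⊎some≤ ⟨ L ∣ R ⟩ R′
  ... | inj₁ L⧏H | inj₁ G⧏R′ = inj₁ (le L⧏H G⧏R′)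
  ... | inj₂ (_ , x∈ , H≤x) | _ = inj₂ (⧏L x∈ H≤x)
  ... | inj₁ _ | inj₂ (_ , y∈ , y≤G) = inj₂ (⧏R y∈ y≤G)

  all⧏⊎some≥ : ∀ L H → (∀ {x} → x ∈ L → x ⧏ H) ⊎ ∃ λ x → x ∈ L × H ≤ x
  all⧏⊎some≥ [] H = inj₁ λ ()
  all⧏⊎some≥ (x ∷ L) H with ≤⊎⧏ H x | all⧏⊎some≥ L H
  ... | inj₁ H≤x | _ = inj₂ (x , here refl , H≤x)
  ... | inj₂ x⧏H | inj₁ L⧏H = inj₁ λ { (here refl) → x⧏H ; (there x∈) → L⧏H x∈ }
  ... | inj₂ _ | inj₂ (y , y∈ , H≤y) = inj₂ (y , there y∈ , H≤y)

  all⧏⊎some≤ : ∀ G R → (∀ {y} → y ∈ R → G ⧏ y) ⊎ ∃ λ y → y ∈ R × y ≤ G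
  all⧏⊎some≤ G [] = inj₁ λ ()
  all⧏⊎some≤ G (y ∷ R) with ≤⊎⧏ y G | all⧏⊎some≤ G R
  ... | inj₁ y≤G | _ = inj₂ (y , here refl , y≤G)
  ... | inj₂ G⧏y | inj₁ G⧏R = inj₁ λ { (here refl) → G⧏y ; (there y∈) → G⧏R y∈ }
  ... | inj₂ _ | inj₂ (z , z∈ , z≤G) = inj₂ (z , there z∈ , z≤G)

_≤?_ : ∀ G H → Dec (G ≤ H)
G ≤? H = [ yes , (λ H⧏G → no λ G≤H → ≤⇒¬⧏ G≤H H⧏G) ]′ (≤⊎⧏ G H)

_⧏?_ : ∀ G H → Dec (G ⧏ H)
G ⧏? H = [ (λ H≤G → no (≤⇒¬⧏ H≤G)) , yes ]′ (≤⊎⧏ H G)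

_≈?_ : ∀ G H → Dec (G ≈ H)
G ≈? H = (G ≤? H) ×-dec (H ≤? G)

Straddles : Game → Set
Straddles x = (∀ {y} → y ∈ Ls x → y ≤ x) × (∀ {y} → y ∈ Rs x → x ≤ y)

Fits : Game → Game → Set
Fits H x = All (_⧏ x) (Ls H) × All (x ⧏_) (Rs H)

fits? : ∀ H x → Dec (Fits H x)
fits? H x = all? (_⧏? x) (Ls H) ×-dec all? (x ⧏?_) (Rs H)

≈-if-no-option-fits : ∀ {H x} → Straddles x → Fits H x →
                      ¬ Any (Fits H) (Ls x) → ¬ Any (Fits H) (Rs x) → H ≈ x
≈-if-no-option-fits {H} {x} (xL≤x , x≤xR) (HL⧏x , x⧏HR) noneL noneR =
  le (All.lookup HL⧏x) H⧏xR , le xL⧏H (All.lookup x⧏HR)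
  where
    H⧏xR : ∀ {y} → y ∈ Rs x → H ⧏ y
    H⧏xR {y} y∈ with ≤⊎⧏ y H
    ... | inj₂ H⧏y = H⧏y
    ... | inj₁ (le _ y⧏HR) =
      ⊥-elim (noneR (lose y∈ (All.map (λ h⧏x → ⧏-≤-trans h⧏x (x≤xR y∈)) HL⧏x , All.tabulate y⧏HR)))

    xL⧏H : ∀ {y} → y ∈ Ls x → y ⧏ H
    xL⧏H {y} y∈ with ≤⊎⧏ H y
    ... | inj₂ y⧏H = y⧏H
    ... | inj₁ (le HL⧏y _) =
      ⊥-elim (noneL (lose y∈ (All.tabulate HL⧏y , All.map (λ x⧏h → ≤-⧏-trans (xL≤x y∈) x⧏h) x⧏HR)))

≈-one-option-each : ∀ {G a b} → a ⧏ G → G ⧏ b →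
                    (∀ {x} → x ∈ Ls G → x ≤ a) → (∀ {y} → y ∈ Rs G → b ≤ y) →
                    G ≈ ⟨ [ a ] ∣ [ b ] ⟩
≈-one-option-each a⧏G G⧏b GL≤a b≤GR =
  le (λ x∈ → ⧏L (here refl) (GL≤a x∈)) (λ { (here refl) → G⧏b ; (there ()) }) ,
  le (λ { (here refl) → a⧏G ; (there ()) }) (λ y∈ → ⧏R (here refl) (b≤GR y∈))

<-leftOption : ∀ {x L R} → x ∈ L → (∀ {y} → y ∈ Ls x → y ≤ x) → (∀ {r} → r ∈ R → x ⧏ r) →
               x < ⟨ L ∣ R ⟩
<-leftOption x∈L xL≤x x⧏R = le (λ y∈ → ⧏L x∈L (xL≤x y∈)) x⧏R , ⧏L x∈L (≤-refl _)

<-rightOption : ∀ {y L R} → y ∈ R → (∀ {z} → z ∈ Rs y → y ≤ z) → (∀ {l} → l ∈ L → l ⧏ y) →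
                ⟨ L ∣ R ⟩ < y
<-rightOption y∈R y≤yR L⧏y = le L⧏y (λ z∈ → ⧏R y∈R (y≤yR z∈)) , ⧏R y∈R (≤-refl _)

⟨x∣y⟩-between : ∀ {x y} → Straddles x → Straddles y → x ⧏ y →
                x < ⟨ [ x ] ∣ [ y ] ⟩ × ⟨ [ x ] ∣ [ y ] ⟩ < y
⟨x∣y⟩-between (xL≤x , _) (_ , y≤yR) x⧏y =
  <-leftOption (here refl) xL≤x (λ { (here refl) → x⧏y ; (there ()) }) ,
  <-rightOption (here refl) y≤yR (λ { (here refl) → x⧏y ; (there ()) })

⟨x∣y⟩-straddles : ∀ {x y} → Straddles x → Straddles y → x ⧏ y → Straddles ⟨ [ x ] ∣ [ y ] ⟩
⟨x∣y⟩-straddles x-str y-str x⧏y =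
  let (x≤xy , _) , (xy≤y , _) = ⟨x∣y⟩-between x-str y-str x⧏y
  in (λ { (here refl) → x≤xy ; (there ()) }) , (λ { (here refl) → xy≤y ; (there ()) })

module _ {P : Game → Set} (total : ∀ {y z} → P y → P z → y ≤ z ⊎ z ≤ y) where
  maximum : ∀ x xs → (∀ {z} → z ∈ x ∷ xs → P z) →
            ∃ λ m → m ∈ x ∷ xs × (∀ {z} → z ∈ x ∷ xs → z ≤ m)
  maximum x [] _ = x , here refl , λ { (here refl) → ≤-refl x ; (there ()) }
  maximum x (y ∷ ys) all-P with maximum y ys (λ z∈ → all-P (there z∈))
  ... | m , m∈ , ≤m with total (all-P (here refl)) (all-P (there m∈))
  ...   | inj₁ x≤m = m , there m∈ , λ { (here refl) → x≤m ; (there z∈) → ≤m z∈ }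
  ...   | inj₂ m≤x = x , here refl , λ { (here refl) → ≤-refl x ; (there z∈) → ≤-trans (≤m z∈) m≤x }

  minimum : ∀ x xs → (∀ {z} → z ∈ x ∷ xs → P z) →
            ∃ λ m → m ∈ x ∷ xs × (∀ {z} → z ∈ x ∷ xs → m ≤ z)
  minimum x [] _ = x , here refl , λ { (here refl) → ≤-refl x ; (there ()) }
  minimum x (y ∷ ys) all-P with minimum y ys (λ z∈ → all-P (there z∈))
  ... | m , m∈ , m≤ with total (all-P (here refl)) (all-P (there m∈))
  ...   | inj₂ m≤x = m , there m∈ , λ { (here refl) → m≤x ; (there z∈) → m≤ z∈ }
  ...   | inj₁ x≤m = x , here refl , λ { (here refl) → ≤-refl x ; (there z∈) → ≤-trans x≤m (m≤ z∈) }

-- Numbers, stops and guides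

record IsNumberSystem (A : NumSys) : Set where
  open NumSys A
  field
    options-emb         : ∀ a {y} → y ∈ Ls (emb a) ⊎ y ∈ Rs (emb a) → ∃ λ b → y ≡ emb b
    emb-straddles       : ∀ a → Straddles (emb a)
    emb-mono            : ∀ {a b} → a ≤ₐ b → emb a ≤ emb b
    ≤ₐ-total            : ∀ a b → a ≤ₐ b ⊎ b ≤ₐ a
    emb-unbounded-below : ∀ a → ∃ λ c → emb c ⧏ emb a
    emb-unbounded-above : ∀ a → ∃ λ c → emb a ⧏ emb c
    emb-InAA            : ∀ a → InAA A (emb a)
    inhabitant          : Carrier

module NumberSystemProperties (A : NumSys) (isNumberSystem : IsNumberSystem A) where
  open NumSys A
  open IsNumberSystem isNumberSystem

  simplicity : ∀ H a → Fits H (emb a) → InA A H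
  simplicity H a = game-ind P step (emb a) (a , refl)
    where
      P : Game → Set
      P x = (∃ λ a → x ≡ emb a) → Fits H x → InA A H

      step : ∀ x → (∀ {y} → y ∈ Ls x → P y) → (∀ {y} → y ∈ Rs x → P y) → P x
      step _ ihL ihR (a , refl) fits
        with any? (fits? H) (Ls (emb a)) | any? (fits? H) (Rs (emb a))
      ... | yes someL | _ =
        let y , y∈ , fitsʸ = find someL in ihL y∈ (options-emb a (inj₁ y∈)) fitsʸ
      ... | no _ | yes someR =
        let y , y∈ , fitsʸ = find someR in ihR y∈ (options-emb a (inj₂ y∈)) fitsʸ
      ... | no noneL | no noneR = a , ≈-if-no-option-fits (emb-straddles a) fits noneL noneR

  emb-total : ∀ a b → emb a ≤ emb b ⊎ emb b ≤ emb a
  emb-total a b = Sum.map emb-mono emb-mono (≤ₐ-total a b)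

  ⧏⇒≤ : ∀ {a b} → emb a ⧏ emb b → emb a ≤ emb b
  ⧏⇒≤ {a} {b} a⧏b = [ id , (λ b≤a → ⊥-elim (≤⇒¬⧏ b≤a a⧏b)) ]′ (emb-total a b)

  InA-total : ∀ {y z} → InA A y → InA A z → y ≤ z ⊎ z ≤ y
  InA-total (a , y≤a , a≤y) (b , z≤b , b≤z) =
    Sum.map (λ a≤b → ≤-trans y≤a (≤-trans a≤b b≤z)) (λ b≤a → ≤-trans z≤b (≤-trans b≤a a≤y))
            (emb-total a b)

  -- A left option c^L with G ≤ c^L would fit between the options of G.
  emb≤-if-⧏-rightOptions : ∀ {G c} → ¬ InA A G → (∀ {r} → r ∈ Rs G → emb c ⧏ r) → emb c ≤ G
  emb≤-if-⧏-rightOptions {G} {c} G∉A c⧏GR = le cL⧏G c⧏GR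
    where
      cL⧏G : ∀ {x} → x ∈ Ls (emb c) → x ⧏ G
      cL⧏G x∈ with ≤⊎⧏ G _ | options-emb c (inj₁ x∈)
      ... | inj₂ x⧏G | _ = x⧏G
      ... | inj₁ (le GL⧏x _) | d , refl =
        let c-x≤c = proj₁ (emb-straddles c) x∈
        in ⊥-elim (G∉A (simplicity G d (All.tabulate GL⧏x ,
                                        All.tabulate (λ r∈ → ≤-⧏-trans c-x≤c (c⧏GR r∈)))))

  ≤emb-if-leftOptions-⧏ : ∀ {G c} → ¬ InA A G → (∀ {l} → l ∈ Ls G → l ⧏ emb c) → G ≤ emb c
  ≤emb-if-leftOptions-⧏ {G} {c} G∉A GL⧏c = le GL⧏c G⧏cR
    where
      G⧏cR : ∀ {y} → y ∈ Rs (emb c) → G ⧏ y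
      G⧏cR y∈ with ≤⊎⧏ _ G | options-emb c (inj₂ y∈)
      ... | inj₂ G⧏y | _ = G⧏y
      ... | inj₁ (le _ y⧏GR) | d , refl =
        let c≤c-y = proj₂ (emb-straddles c) y∈
        in ⊥-elim (G∉A (simplicity G d (All.tabulate (λ l∈ → ⧏-≤-trans (GL⧏c l∈) c≤c-y) ,
                                        All.tabulate y⧏GR)))

  OptionsInA : Game → Set
  OptionsInA y = (∀ {z} → z ∈ Ls y → InA A z) × (∀ {z} → z ∈ Rs y → InA A z)

  InA⊎OptionsInA : Game → Set
  InA⊎OptionsInA y = InA A y ⊎ OptionsInA y

  optionsInA : ∀ {y} → InA⊎OptionsInA y → ¬ InA A y → OptionsInA y
  optionsInA (inj₁ y∈A) y∉A = ⊥-elim (y∉A y∈A)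
  optionsInA (inj₂ y-options) _ = y-options

  InA⇒LS≈ : ∀ {y b} → InA A y → LS A y b → y ≈ emb b
  InA⇒LS≈ _ (LS-num y≈b) = y≈b
  InA⇒LS≈ y∈A (LS-game y∉A _ _) = ⊥-elim (y∉A y∈A)

  InA⇒RS≈ : ∀ {y b} → InA A y → RS A y b → y ≈ emb b
  InA⇒RS≈ _ (RS-num y≈b) = y≈b
  InA⇒RS≈ y∈A (RS-game y∉A _ _) = ⊥-elim (y∉A y∈A)

  emb≤⇒≈RS⊎⧏RS : ∀ {y b c} → InA⊎OptionsInA y → RS A y b → emb c ≤ y → y ≈ emb b ⊎ emb c ⧏ emb b
  emb≤⇒≈RS⊎⧏RS _ (RS-num y≈b) _ = inj₁ y≈b
  emb≤⇒≈RS⊎⧏RS y-shape (RS-game y∉A some-r _) (le _ c⧏yR) =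
    let r , r∈ , LS-r-b = find some-r
    in inj₂ (⧏-≤-trans (c⧏yR r∈) (proj₁ (InA⇒LS≈ (proj₂ (optionsInA y-shape y∉A) r∈) LS-r-b)))

  ≤emb⇒≈LS⊎LS⧏ : ∀ {y b c} → InA⊎OptionsInA y → LS A y b → y ≤ emb c → y ≈ emb b ⊎ emb b ⧏ emb c
  ≤emb⇒≈LS⊎LS⧏ _ (LS-num y≈b) _ = inj₁ y≈b
  ≤emb⇒≈LS⊎LS⧏ y-shape (LS-game y∉A some-l _) (le yL⧏c _) =
    let l , l∈ , RS-l-b = find some-l
    in inj₂ (≤-⧏-trans (proj₂ (InA⇒RS≈ (proj₁ (optionsInA y-shape y∉A) l∈) RS-l-b)) (yL⧏c l∈))

  emb≤-RS≤⇒⧏⊎≈ : ∀ {y b c l} → InA⊎OptionsInA y → RS A y b → b ≤ₐ l → emb c ≤ y →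
                 emb c ⧏ emb l ⊎ y ≈ emb l
  emb≤-RS≤⇒⧏⊎≈ {l = l} y-shape RS-y-b b≤l c≤y with emb≤⇒≈RS⊎⧏RS y-shape RS-y-b c≤y
  ... | inj₂ c⧏b = inj₁ (⧏-≤-trans c⧏b (emb-mono b≤l))
  ... | inj₁ (y≤b , b≤y) with ≤⊎⧏ (emb l) _
  ...   | inj₁ l≤b = inj₂ (≤-trans y≤b (emb-mono b≤l) , ≤-trans l≤b b≤y)
  ...   | inj₂ b⧏l = inj₁ (≤-⧏-trans (≤-trans c≤y y≤b) b⧏l)

  ≤emb-≤LS⇒⧏⊎≈ : ∀ {y b c r} → InA⊎OptionsInA y → LS A y b → r ≤ₐ b → y ≤ emb c →
                 emb r ⧏ emb c ⊎ y ≈ emb r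
  ≤emb-≤LS⇒⧏⊎≈ {r = r} y-shape LS-y-b r≤b y≤c with ≤emb⇒≈LS⊎LS⧏ y-shape LS-y-b y≤c
  ... | inj₂ b⧏c = inj₁ (≤-⧏-trans (emb-mono r≤b) b⧏c)
  ... | inj₁ (y≤b , b≤y) with ≤⊎⧏ _ (emb r)
  ...   | inj₁ b≤r = inj₂ (≤-trans y≤b b≤r , ≤-trans (emb-mono r≤b) b≤y)
  ...   | inj₂ r⧏b = inj₁ (⧏-≤-trans r⧏b (≤-trans b≤y y≤c))

  ⧏RS⇒emb≤ : ∀ {y l c} → InA⊎OptionsInA y → RS A y l → emb c ⧏ emb l → emb c ≤ y
  ⧏RS⇒emb≤ _ (RS-num (_ , l≤y)) c⧏l = ≤-trans (⧏⇒≤ c⧏l) l≤y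
  ⧏RS⇒emb≤ {y} {c = c} y-shape (RS-game y∉A _ LS≥l) c⧏l = emb≤-if-⧏-rightOptions y∉A c⧏yR
    where
      c⧏yR : ∀ {r} → r ∈ Rs y → emb c ⧏ r
      c⧏yR r∈ =
        let b , LS-r-b , l≤b = All.lookup LS≥l r∈
            _ , b≤r = InA⇒LS≈ (proj₂ (optionsInA y-shape y∉A) r∈) LS-r-b
        in ⧏-≤-trans (⧏-≤-trans c⧏l (emb-mono l≤b)) b≤r

  LS⧏⇒≤emb : ∀ {y r c} → InA⊎OptionsInA y → LS A y r → emb r ⧏ emb c → y ≤ emb c
  LS⧏⇒≤emb _ (LS-num (y≤r , _)) r⧏c = ≤-trans y≤r (⧏⇒≤ r⧏c)
  LS⧏⇒≤emb {y} {c = c} y-shape (LS-game y∉A _ RS≤r) r⧏c = ≤emb-if-leftOptions-⧏ y∉A yL⧏c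
    where
      yL⧏c : ∀ {l} → l ∈ Ls y → l ⧏ emb c
      yL⧏c l∈ =
        let b , RS-l-b , b≤r = All.lookup RS≤r l∈
            l≤b , _ = InA⇒RS≈ (proj₁ (optionsInA y-shape y∉A) l∈) RS-l-b
        in ≤-⧏-trans l≤b (≤-⧏-trans (emb-mono b≤r) r⧏c)

  -- c lies below the left stop l of G, strictly unless h = l; the guide equals l if some left
  -- option does, and otherwise has right stop l.
  emb≤leftGuide : ∀ {G GL c h} → (∀ {y} → y ∈ Ls G → InA⊎OptionsInA y) →
                  GdL A G GL → h ∈ Ls G → emb c ≤ h → emb c ≤ GL
  emb≤leftGuide _ (G∉A , _ , l , LS-num G≈l , _) _ _ = ⊥-elim (G∉A (l , G≈l))
  emb≤leftGuide {G} shape (_ , GL∈ , l , LS-game _ _ RS≤l , guideIfAny , guideIfNone) h∈ c≤h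
    with All.lookup RS≤l h∈
  ... | b , RS-h-b , b≤l with any? (_≈? emb l) (Ls G) | emb≤-RS≤⇒⧏⊎≈ (shape h∈) RS-h-b b≤l c≤h
  ...   | yes some≈l | inj₁ c⧏l = ≤-trans (⧏⇒≤ c⧏l) (proj₂ (guideIfAny some≈l))
  ...   | yes some≈l | inj₂ (h≤l , _) = ≤-trans c≤h (≤-trans h≤l (proj₂ (guideIfAny some≈l)))
  ...   | no none≈l | inj₁ c⧏l = ⧏RS⇒emb≤ (shape GL∈) (guideIfNone none≈l) c⧏l
  ...   | no none≈l | inj₂ h≈l = ⊥-elim (none≈l (lose h∈ h≈l))

  rightGuide≤emb : ∀ {G GR c h} → (∀ {y} → y ∈ Rs G → InA⊎OptionsInA y) →
                   GdR A G GR → h ∈ Rs G → h ≤ emb c → GR ≤ emb c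
  rightGuide≤emb _ (G∉A , _ , r , RS-num G≈r , _) _ _ = ⊥-elim (G∉A (r , G≈r))
  rightGuide≤emb {G} shape (_ , GR∈ , r , RS-game _ _ LS≥r , guideIfAny , guideIfNone) h∈ h≤c
    with All.lookup LS≥r h∈
  ... | b , LS-h-b , r≤b with any? (_≈? emb r) (Rs G) | ≤emb-≤LS⇒⧏⊎≈ (shape h∈) LS-h-b r≤b h≤c
  ...   | yes some≈r | inj₁ r⧏c = ≤-trans (proj₁ (guideIfAny some≈r)) (⧏⇒≤ r⧏c)
  ...   | yes some≈r | inj₂ (_ , r≤h) = ≤-trans (proj₁ (guideIfAny some≈r)) (≤-trans r≤h h≤c)
  ...   | no none≈r | inj₁ r⧏c = LS⧏⇒≤emb (shape GR∈) (guideIfNone none≈r) r⧏c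
  ...   | no none≈r | inj₂ h≈r = ⊥-elim (none≈r (lose h∈ h≈r))

  diamond⇒InA : ∀ {G} → (∀ {y} → y ∈ Ls G ⊎ y ∈ Rs G → InA⊎OptionsInA y) → Diamond A G → InA A G
  diamond⇒InA _ (inj₁ G∈A) = G∈A
  diamond⇒InA {G} shape (inj₂ (GL , GR , c , gdL , gdR , GL≱c , c≱GR)) =
    simplicity G c (All.tabulate GL⧏c , All.tabulate c⧏GR)
    where
      GL⧏c : ∀ {h} → h ∈ Ls G → h ⧏ emb c
      GL⧏c h∈ with ≤⊎⧏ (emb c) _
      ... | inj₁ c≤h = ⊥-elim (GL≱c (emb≤leftGuide (λ y∈ → shape (inj₁ y∈)) gdL h∈ c≤h))
      ... | inj₂ h⧏c = h⧏c

      c⧏GR : ∀ {h} → h ∈ Rs G → emb c ⧏ h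
      c⧏GR h∈ with ≤⊎⧏ _ (emb c)
      ... | inj₁ h≤c = ⊥-elim (c≱GR (rightGuide≤emb (λ y∈ → shape (inj₂ y∈)) gdR h∈ h≤c))
      ... | inj₂ c⧏h = c⧏h

  InA⇒InAA : ∀ {H} → InA A H → InAA A H
  InA⇒InAA (a , H≈a) = let b , c , a≈bc = emb-InAA a in b , c , ≈-trans H≈a a≈bc

  OptionsInA⇒InAA : ∀ H → OptionsInA H → InAA A H
  OptionsInA⇒InAA ⟨ [] ∣ [] ⟩ _ = InA⇒InAA (simplicity _ inhabitant ([] , []))
  OptionsInA⇒InAA ⟨ [] ∣ y ∷ ys ⟩ (_ , R∈A) =
    let n , n∈ , n≤R = minimum InA-total y ys R∈A
        b , _ , b≤n = R∈A n∈
        c , c⧏b = emb-unbounded-below b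
    in InA⇒InAA (simplicity _ c ([] , All.tabulate λ z∈ → ⧏-≤-trans c⧏b (≤-trans b≤n (n≤R z∈))))
  OptionsInA⇒InAA ⟨ x ∷ xs ∣ [] ⟩ (L∈A , _) =
    let m , m∈ , L≤m = maximum InA-total x xs L∈A
        a , m≤a , _ = L∈A m∈
        c , a⧏c = emb-unbounded-above a
    in InA⇒InAA (simplicity _ c (All.tabulate (λ z∈ → ≤-⧏-trans (≤-trans (L≤m z∈) m≤a) a⧏c) , []))
  OptionsInA⇒InAA ⟨ x ∷ xs ∣ y ∷ ys ⟩ (L∈A , R∈A) =
    let m , m∈ , L≤m = maximum InA-total x xs L∈A
        n , n∈ , n≤R = minimum InA-total y ys R∈A
        a , m≤a , a≤m = L∈A m∈
        b , n≤b , b≤n = R∈A n∈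
    in a , b , ≈-one-option-each (⧏L m∈ a≤m) (⧏R n∈ n≤b)
                                 (λ z∈ → ≤-trans (L≤m z∈) m≤a) (λ z∈ → ≤-trans b≤n (n≤R z∈))

  𝒟-InA×𝒮-OptionsInA : ∀ {𝒢 𝒟 𝒮 : Game → Set} → ClosedUnderOptions 𝒢 →
    (∀ G → 𝒢 G → 𝒟 G ⊎ 𝒮 G) →
    (∀ G → 𝒟 G → 𝒢 G) →
    (∀ G → 𝒟 G → Diamond A G) →
    (∀ G → 𝒮 G → (∀ x → x ∈ Ls G → 𝒟 x) × (∀ x → x ∈ Rs G → 𝒟 x)) →
    ∀ G → (𝒟 G → InA A G) × (𝒮 G → OptionsInA G)
  𝒟-InA×𝒮-OptionsInA {𝒢} {𝒟} {𝒮} closed split 𝒟⊆𝒢 diamond 𝒮-options = game-ind P step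
    where
      P : Game → Set
      P G = (𝒟 G → InA A G) × (𝒮 G → OptionsInA G)

      step : ∀ G → (∀ {x} → x ∈ Ls G → P x) → (∀ {x} → x ∈ Rs G → P x) → P G
      step G ihL ihR = 𝒟⇒InA , 𝒮⇒OptionsInA
        where
          ih : ∀ {y} → y ∈ Ls G ⊎ y ∈ Rs G → P y
          ih = [ ihL , ihR ]′

          𝒟⇒InA : 𝒟 G → InA A G
          𝒟⇒InA G∈𝒟 = diamond⇒InA shape (diamond G G∈𝒟)
            where
              shape : ∀ {y} → y ∈ Ls G ⊎ y ∈ Rs G → InA⊎OptionsInA y
              shape y∈ = Sum.map (proj₁ (ih y∈)) (proj₂ (ih y∈)) (split _ (closed (𝒟⊆𝒢 G G∈𝒟) y∈))

          𝒮⇒OptionsInA : 𝒮 G → OptionsInA G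
          𝒮⇒OptionsInA G∈𝒮 = (λ y∈ → proj₁ (ihL y∈) (proj₁ (𝒮-options G G∈𝒮) _ y∈)) ,
                              (λ y∈ → proj₁ (ihR y∈) (proj₂ (𝒮-options G G∈𝒮) _ y∈))

-- Integers and dyadic rationals

module _ (f : ℤ → Game) (f-step : ∀ a → f a ≤ f (ℤ.suc a)) where
  ≤-shift : ∀ a k → f a ≤ f (a ℤ.+ + k)
  ≤-shift a zero = subst (λ x → f a ≤ f x) (sym (ℤP.+-identityʳ a)) (≤-refl (f a))
  ≤-shift a (suc k) =
    ≤-trans (≤-shift a k) (subst (λ x → f (a ℤ.+ + k) ≤ f x) (sym (+-suc a (+ k))) (f-step (a ℤ.+ + k)))
    where
      +-suc : ∀ a k → a ℤ.+ (+ 1 ℤ.+ k) ≡ + 1 ℤ.+ (a ℤ.+ k)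
      +-suc = solve-∀

  mono-from-steps : ∀ {a b} → a ℤ.≤ b → f a ≤ f b
  mono-from-steps {a} {b} a≤b = subst (λ x → f a ≤ f x) a+∣b-a∣≡b (≤-shift a ℤ.∣ b ℤ.- a ∣)
    where
      +-minus : ∀ a b → a ℤ.+ (b ℤ.- a) ≡ b
      +-minus = solve-∀
      a+∣b-a∣≡b : a ℤ.+ + ℤ.∣ b ℤ.- a ∣ ≡ b
      a+∣b-a∣≡b = trans (cong (λ x → a ℤ.+ x) (ℤP.0≤i⇒+∣i∣≡i (ℤP.i≤j⇒0≤j-i a≤b))) (+-minus a b)

intG-straddles : ∀ a → Straddles (intG a)
intG-straddles (+ n) = nonNegative n
  where
    nonNegative : ∀ n → Straddles (intG (+ n))
    nonNegative zero = (λ ()) , (λ ())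
    nonNegative (suc n) = (λ { (here refl) → proj₁ n<1+n ; (there ()) }) , (λ ())
      where
        n<1+n : intG (+ n) < intG (+ suc n)
        n<1+n = <-leftOption (here refl) (proj₁ (nonNegative n)) (λ ())
intG-straddles -[1+ n ] = negative n
  where
    negative : ∀ n → Straddles (intG -[1+ n ])
    negative zero = (λ ()) , (λ { (here refl) → proj₁ -1<0 ; (there ()) })
      where
        -1<0 : intG -[1+ 0 ] < intG (+ 0)
        -1<0 = <-rightOption (here refl) (λ ()) (λ ())
    negative (suc n) = (λ ()) , (λ { (here refl) → proj₁ -2-n<-1-n ; (there ()) })
      where
        -2-n<-1-n : intG -[1+ suc n ] < intG -[1+ n ]
        -2-n<-1-n = <-rightOption (here refl) (proj₂ (negative n)) (λ ())

intG-<-suc : ∀ a → intG a < intG (ℤ.suc a)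
intG-<-suc (+ n) = <-leftOption (here refl) (proj₁ (intG-straddles (+ n))) (λ ())
intG-<-suc -[1+ zero ] = <-rightOption (here refl) (λ ()) (λ ())
intG-<-suc -[1+ suc n ] = <-rightOption (here refl) (proj₂ (intG-straddles -[1+ n ])) (λ ())

intG-options : ∀ a {y} → y ∈ Ls (intG a) ⊎ y ∈ Rs (intG a) → ∃ λ b → y ≡ intG b
intG-options (+ zero) (inj₁ ())
intG-options (+ zero) (inj₂ ())
intG-options (+ suc n) (inj₁ (here refl)) = + n , refl
intG-options (+ suc n) (inj₁ (there ()))
intG-options (+ suc n) (inj₂ ())
intG-options -[1+ zero ] (inj₁ ())
intG-options -[1+ zero ] (inj₂ (here refl)) = + 0 , refl
intG-options -[1+ zero ] (inj₂ (there ()))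
intG-options -[1+ suc n ] (inj₁ ())
intG-options -[1+ suc n ] (inj₂ (here refl)) = -[1+ n ] , refl
intG-options -[1+ suc n ] (inj₂ (there ()))

dyG-unfold : ∀ p k →
  (p ≡ (p /ℕ 2) ℤ.* + 2 × dyG p (suc k) ≡ dyG (p /ℕ 2) k) ⊎
  (p ≡ ℤ.suc ((p /ℕ 2) ℤ.* + 2) ×
   dyG p (suc k) ≡ ⟨ [ dyG (p /ℕ 2) k ] ∣ [ dyG ((p /ℕ 2) ℤ.+ + 1) k ] ⟩)
dyG-unfold p k with p %ℕ 2 | a≡a%ℕn+[a/ℕn]*n p 2 | n%ℕd<d p 2
... | zero | p≡q*2 | _ = inj₁ (trans p≡q*2 (ℤP.+-identityˡ _) , refl)
... | suc zero | p≡1+q*2 | _ = inj₂ (p≡1+q*2 , refl)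
... | suc (suc _) | _ | ℕ.s≤s (ℕ.s≤s ())

odd≢even : ∀ q b → ℤ.suc (q ℤ.* + 2) ≢ b ℤ.* + 2
odd≢even q b odd≡even =
  1≢n*2 ℤ.∣ b ℤ.- q ∣ (trans (cong ℤ.∣_∣ 1≡[b-q]*2) (ℤP.∣i*j∣≡∣i∣*∣j∣ (b ℤ.- q) (+ 2)))
  where
    open ≡-Reasoning
    [1+q*2]-q*2≡1 : ∀ q → + 1 ℤ.+ q ℤ.* + 2 ℤ.- q ℤ.* + 2 ≡ + 1
    [1+q*2]-q*2≡1 = solve-∀
    b*2-q*2≡[b-q]*2 : ∀ b q → b ℤ.* + 2 ℤ.- q ℤ.* + 2 ≡ (b ℤ.- q) ℤ.* + 2
    b*2-q*2≡[b-q]*2 = solve-∀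
    1≡[b-q]*2 : + 1 ≡ (b ℤ.- q) ℤ.* + 2
    1≡[b-q]*2 = begin
      + 1                                   ≡⟨ sym ([1+q*2]-q*2≡1 q) ⟩
      ℤ.suc (q ℤ.* + 2) ℤ.- q ℤ.* + 2       ≡⟨ cong (λ x → x ℤ.- q ℤ.* + 2) odd≡even ⟩
      b ℤ.* + 2 ℤ.- q ℤ.* + 2               ≡⟨ b*2-q*2≡[b-q]*2 b q ⟩
      (b ℤ.- q) ℤ.* + 2                     ∎
    1≢n*2 : ∀ n → 1 ≢ n ℕ.* 2
    1≢n*2 zero ()
    1≢n*2 (suc n) ()

dyG-even : ∀ b k → dyG (b ℤ.* + 2) (suc k) ≡ dyG b k
dyG-even b k with dyG-unfold (b ℤ.* + 2) k
... | inj₁ (b*2≡q*2 , unfold) =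
  trans unfold (cong (λ q → dyG q k) (sym (ℤP.*-cancelʳ-≡ b _ (+ 2) b*2≡q*2)))
... | inj₂ (b*2≡1+q*2 , _) = ⊥-elim (odd≢even ((b ℤ.* + 2) /ℕ 2) b (sym b*2≡1+q*2))

dyG-odd : ∀ b k → dyG (ℤ.suc (b ℤ.* + 2)) (suc k) ≡ ⟨ [ dyG b k ] ∣ [ dyG (ℤ.suc b) k ] ⟩
dyG-odd b k with dyG-unfold (ℤ.suc (b ℤ.* + 2)) k
... | inj₁ (1+b*2≡q*2 , _) = ⊥-elim (odd≢even b (ℤ.suc (b ℤ.* + 2) /ℕ 2) 1+b*2≡q*2)
... | inj₂ (1+b*2≡1+q*2 , unfold) = begin
  dyG (ℤ.suc (b ℤ.* + 2)) (suc k)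
    ≡⟨ unfold ⟩
  ⟨ [ dyG q k ] ∣ [ dyG (q ℤ.+ + 1) k ] ⟩
    ≡⟨ cong (λ x → ⟨ [ dyG x k ] ∣ [ dyG (x ℤ.+ + 1) k ] ⟩) q≡b ⟩
  ⟨ [ dyG b k ] ∣ [ dyG (b ℤ.+ + 1) k ] ⟩
    ≡⟨ cong (λ x → ⟨ [ dyG b k ] ∣ [ dyG x k ] ⟩) (ℤP.+-comm b (+ 1)) ⟩
  ⟨ [ dyG b k ] ∣ [ dyG (ℤ.suc b) k ] ⟩
    ∎
  where
    open ≡-Reasoning
    suc-injective : ∀ {i j} → ℤ.suc i ≡ ℤ.suc j → i ≡ j
    suc-injective {i} {j} eq = trans (sym (ℤP.pred-suc i)) (trans (cong ℤ.pred eq) (ℤP.pred-suc j))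
    q : ℤ
    q = ℤ.suc (b ℤ.* + 2) /ℕ 2
    q≡b : q ≡ b
    q≡b = sym (ℤP.*-cancelʳ-≡ b q (+ 2) (suc-injective 1+b*2≡1+q*2))

even-or-odd : ∀ p → ∃ λ b → p ≡ b ℤ.* + 2 ⊎ p ≡ ℤ.suc (b ℤ.* + 2)
even-or-odd p = p /ℕ 2 , Sum.map proj₁ proj₁ (dyG-unfold p 0)

1+[1+b*2]≡[1+b]*2 : ∀ b → + 1 ℤ.+ (+ 1 ℤ.+ b ℤ.* + 2) ≡ (+ 1 ℤ.+ b) ℤ.* + 2
1+[1+b*2]≡[1+b]*2 = solve-∀

mutual
  dyG-straddles : ∀ k m → Straddles (dyG m k)
  dyG-straddles zero m = intG-straddles m
  dyG-straddles (suc k) m with even-or-odd m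
  ... | b , inj₁ refl rewrite dyG-even b k = dyG-straddles k b
  ... | b , inj₂ refl rewrite dyG-odd b k =
    ⟨x∣y⟩-straddles (dyG-straddles k b) (dyG-straddles k (ℤ.suc b)) (proj₂ (dyG-<-suc k b))

  dyG-<-suc : ∀ k m → dyG m k < dyG (ℤ.suc m) k
  dyG-<-suc zero m = intG-<-suc m
  dyG-<-suc (suc k) m with even-or-odd m
  ... | b , inj₁ refl rewrite dyG-even b k | dyG-odd b k =
    proj₁ (⟨x∣y⟩-between (dyG-straddles k b) (dyG-straddles k (ℤ.suc b)) (proj₂ (dyG-<-suc k b)))
  ... | b , inj₂ refl rewrite dyG-odd b k | 1+[1+b*2]≡[1+b]*2 b | dyG-even (ℤ.suc b) k =
    proj₂ (⟨x∣y⟩-between (dyG-straddles k b) (dyG-straddles k (ℤ.suc b)) (proj₂ (dyG-<-suc k b)))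

dyG-pred< : ∀ k m → dyG (ℤ.pred m) k < dyG m k
dyG-pred< k m = subst (λ x → dyG (ℤ.pred m) k < dyG x k) (ℤP.suc-pred m) (dyG-<-suc k (ℤ.pred m))

intG-≈⟨pred∣suc⟩ : ∀ a → intG a ≈ ⟨ [ intG (ℤ.pred a) ] ∣ [ intG (ℤ.suc a) ] ⟩
intG-≈⟨pred∣suc⟩ a =
  ≈-one-option-each (proj₂ (dyG-pred< 0 a)) (proj₂ (intG-<-suc a)) (left a) (right a)
  where
    left : ∀ a {x} → x ∈ Ls (intG a) → x ≤ intG (ℤ.pred a)
    left (+ suc n) (here refl) = ≤-refl _
    left (+ suc n) (there ())
    left (+ zero) ()
    left -[1+ zero ] ()
    left -[1+ suc n ] ()
    right : ∀ a {y} → y ∈ Rs (intG a) → intG (ℤ.suc a) ≤ y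
    right -[1+ zero ] (here refl) = ≤-refl _
    right -[1+ zero ] (there ())
    right -[1+ suc n ] (here refl) = ≤-refl _
    right -[1+ suc n ] (there ())
    right (+ zero) ()
    right (+ suc n) ()

dyG-mono-level : ∀ k {m n} → m ℤ.≤ n → dyG m k ≤ dyG n k
dyG-mono-level k = mono-from-steps (λ m → dyG m k) (λ m → proj₁ (dyG-<-suc k m))

dyG-lift : ∀ d m k → dyG m k ≡ dyG (m ℤ.* + (2 ^ d)) (d ℕ.+ k)
dyG-lift zero m k = cong (λ x → dyG x k) (sym (ℤP.*-identityʳ m))
dyG-lift (suc d) m k = begin
  dyG m k
    ≡⟨ dyG-lift d m k ⟩
  dyG (m ℤ.* + (2 ^ d)) (d ℕ.+ k)
    ≡⟨ dyG-even (m ℤ.* + (2 ^ d)) (d ℕ.+ k) ⟨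
  dyG (m ℤ.* + (2 ^ d) ℤ.* + 2) (suc d ℕ.+ k)
    ≡⟨ cong (λ x → dyG x (suc d ℕ.+ k)) (m*x*2≡m*[2*x] m (+ (2 ^ d))) ⟩
  dyG (m ℤ.* (+ 2 ℤ.* + (2 ^ d))) (suc d ℕ.+ k)
    ≡⟨ cong (λ x → dyG (m ℤ.* x) (suc d ℕ.+ k)) (ℤP.pos-* 2 (2 ^ d)) ⟨
  dyG (m ℤ.* + (2 ^ suc d)) (suc d ℕ.+ k)
    ∎
  where
    open ≡-Reasoning
    m*x*2≡m*[2*x] : ∀ m x → m ℤ.* x ℤ.* + 2 ≡ m ℤ.* (+ 2 ℤ.* x)
    m*x*2≡m*[2*x] = solve-∀

dyG-mono : ∀ {m k n j} → (m , k) ≤𝔻 (n , j) → dyG m k ≤ dyG n j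
dyG-mono {m} {k} {n} {j} m/2^k≤n/2^j =
  subst₂ _≤_ (sym (dyG-lift j m k)) (sym (trans (dyG-lift k n j) (cong (dyG _) (ℕP.+-comm k j))))
    (dyG-mono-level (j ℕ.+ k) m/2^k≤n/2^j)

dyG-options : ∀ k m {y} → y ∈ Ls (dyG m k) ⊎ y ∈ Rs (dyG m k) → ∃₂ λ n j → y ≡ dyG n j
dyG-options zero m y∈ = let n , y≡n = intG-options m y∈ in n , 0 , y≡n
dyG-options (suc k) m y∈ with even-or-odd m
... | b , inj₁ refl rewrite dyG-even b k = dyG-options k b y∈
... | b , inj₂ refl rewrite dyG-odd b k = odd-options y∈
  where
    odd-options : ∀ {y} → y ∈ [ dyG b k ] ⊎ y ∈ [ dyG (ℤ.suc b) k ] → ∃₂ λ n j → y ≡ dyG n j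
    odd-options (inj₁ (here refl)) = b , k , refl
    odd-options (inj₂ (here refl)) = ℤ.suc b , k , refl
    odd-options (inj₁ (there ()))
    odd-options (inj₂ (there ()))

dyG-InAA : ∀ k m → InAA 𝔻Sys (dyG m k)
dyG-InAA zero m = (ℤ.pred m , 0) , (ℤ.suc m , 0) , intG-≈⟨pred∣suc⟩ m
dyG-InAA (suc k) m with even-or-odd m
... | b , inj₁ refl rewrite dyG-even b k = dyG-InAA k b
... | b , inj₂ refl rewrite dyG-odd b k = (b , k) , (ℤ.suc b , k) , ≤-refl _ , ≤-refl _

isNumberSystemℤ : IsNumberSystem ℤSys
isNumberSystemℤ = record
  { options-emb         = intG-options
  ; emb-straddles       = intG-straddles
  ; emb-mono            = dyG-mono-level 0
  ; ≤ₐ-total            = ℤP.≤-total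
  ; emb-unbounded-below = λ a → ℤ.pred a , proj₂ (dyG-pred< 0 a)
  ; emb-unbounded-above = λ a → ℤ.suc a , proj₂ (intG-<-suc a)
  ; emb-InAA            = λ a → ℤ.pred a , ℤ.suc a , intG-≈⟨pred∣suc⟩ a
  ; inhabitant          = + 0
  }

isNumberSystem𝔻 : IsNumberSystem 𝔻Sys
isNumberSystem𝔻 = record
  { options-emb         = λ { (m , k) y∈ → let n , j , y≡dyG = dyG-options k m y∈ in (n , j) , y≡dyG }
  ; emb-straddles       = λ { (m , k) → dyG-straddles k m }
  ; emb-mono            = λ { {m , k} {n , j} → dyG-mono {m} {k} {n} {j} }
  ; ≤ₐ-total            = λ { (m , k) (n , j) → ℤP.≤-total (m ℤ.* + (2 ^ j)) (n ℤ.* + (2 ^ k)) }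
  ; emb-unbounded-below = λ { (m , k) → (ℤ.pred m , k) , proj₂ (dyG-pred< k m) }
  ; emb-unbounded-above = λ { (m , k) → (ℤ.suc m , k) , proj₂ (dyG-<-suc k m) }
  ; emb-InAA            = λ { (m , k) → dyG-InAA k m }
  ; inhabitant          = + 0 , 0
  }

isNumberSystem : ∀ A → IsNumberSystem (sys A)
isNumberSystem Z = isNumberSystemℤ
isNumberSystem D = isNumberSystem𝔻

theorem1 : (A : Which) (𝒢 𝒟 𝒮 : Game → Set) →
    ClosedUnderOptions 𝒢 →
    (∀ G → 𝒢 G → 𝒟 G ⊎ 𝒮 G) →
    (∀ G → 𝒟 G → 𝒢 G) →
    (∀ G → 𝒮 G → 𝒢 G) →
    (∀ G → ¬ (𝒟 G × 𝒮 G)) →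
    (∀ G → 𝒟 G → Diamond (sys A) G) →
    (∀ G → 𝒮 G → (∀ x → x ∈ Ls G → 𝒟 x) × (∀ x → x ∈ Rs G → 𝒟 x)) →
    (∀ G → 𝒢 G → InAA (sys A) G) × (∀ G → 𝒟 G → InA (sys A) G)
theorem1 A 𝒢 𝒟 𝒮 closed split 𝒟⊆𝒢 _ _ diamond 𝒮-options = 𝒢⇒InAA , (λ G → proj₁ (numbers G))
  where
    open NumberSystemProperties (sys A) (isNumberSystem A)

    numbers : ∀ G → (𝒟 G → InA (sys A) G) × (𝒮 G → OptionsInA G)
    numbers = 𝒟-InA×𝒮-OptionsInA closed split 𝒟⊆𝒢 diamond 𝒮-options

    𝒢⇒InAA : ∀ G → 𝒢 G → InAA (sys A) G
    𝒢⇒InAA G G∈𝒢 = [ (λ G∈𝒟 → InA⇒InAA (proj₁ (numbers G) G∈𝒟)) ,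
                      (λ G∈𝒮 → OptionsInA⇒InAA G (proj₂ (numbers G) G∈𝒮)) ]′ (split G G∈𝒢)
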